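{- For every integer $n\ge 3$, $fw(1\,2\ldots n\;2\;1\;3\ldots n\;1)=4$.
   Context: Sequences are written as concatenations of letters. A sequence $s$ contains $u$ if some (not necessarily contiguous) subsequence of $s$ can be changed into $u$ by a one-to-one renaming of letters. An $(r,s)$-formation is a concatenation of $s$ permutations, each of the same set of $r$ distinct letters. The formation width $fw(u)$ is the minimum $s$ such that there exists $r$ for which every $(r,s)$-formation contains $u$. -}

module Defs where

open import Data.Nat using (ℕ; zero; suc; _+_; _<_)
open import Data.List using (List; []; _∷_; _++_; map; concat; length)
open import Data.List.Membership.Propositional using (_∈_)
open import Data.List.Relation.Unary.All using (All)
open import Data.List.Relation.Unary.Unique.Propositional using (Unique)
open import Data.List.Relation.Binary.Sublist.Propositional using (_⊆_)
open import Data.List.Relation.Binary.Permutation.Propositional using (_↭_)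
open import Data.Product using (Σ; ∃; _×_; _,_)
open import Relation.Binary.PropositionalEquality using (_≡_)
open import Relation.Nullary using (¬_)

Seq : Set
Seq = List ℕ

Contains : Seq → Seq → Set
Contains s u = Σ Seq λ v → v ⊆ s × Σ (ℕ → ℕ) λ f →
  ((x y : ℕ) → x ∈ v → y ∈ v → f x ≡ f y → x ≡ y) × map f v ≡ u

IsFormation : ℕ → ℕ → Seq → Set
IsFormation r s w = Σ Seq λ L → Unique L × length L ≡ r ×
  Σ (List Seq) λ ps → length ps ≡ s × All (λ p → p ↭ L) ps × w ≡ concat ps

FwHolds : Seq → ℕ → Set
FwHolds u s = ∃ λ r → (w : Seq) → IsFormation r s w → Contains w u

FwEq : Seq → ℕ → Set
FwEq u k = FwHolds u k × ((s : ℕ) → s < k → ¬ FwHolds u s)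

range : ℕ → ℕ → Seq
range a zero = []
range a (suc m) = a ∷ range (suc a) m

uSeq : ℕ → Seq
uSeq n = range 1 n ++ (2 ∷ 1 ∷ []) ++ range 3 (n Data.Nat.∸ 2) ++ (1 ∷ [])

-- Lower bound: uSeq n contains a b b a a, which has three non-ascents (adjacent x y with y ≤ x),
-- whereas a sublist of s copies of the increasing list 0 1 … r−1 has at most s − 1; so the
-- (r,3)-formation of three increasing copies avoids uSeq n.
-- Upper bound: in an (r,4)-formation P₁P₂P₃P₄ with r large, three applications of
-- Erdős–Szekeres give n letters S, listed in the order of P₁, that occur in each of P₂, P₃, P₄
-- in this order or reversed. Whatever the three orientations, S is a permutation of some
-- x₁ x₂ Y such that the four blocks supply consecutive pieces of x₁ x₂ Y x₂ x₁ Y x₁, the shape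
-- of uSeq n; renaming x₁ x₂ Y to 1 … n then gives the containment.
module Submission where

open import Defs
open import Data.Empty using (⊥-elim)
open import Data.Nat using (ℕ; zero; suc; _+_; _≤_; _<_; _≟_; _≤?_; z≤n; s≤s)
open import Data.Nat.Properties
  using (≤-refl; ≤-reflexive; ≤-trans; <⇒≤; <⇒≢; n≤1+n; <-irrefl; <-cmp; <-≤-trans; ≰⇒>;
         +-monoˡ-<; +-monoʳ-≤; +-cancelˡ-<; +-suc; +-identityʳ; suc-injective; m≤n⇒m⊓n≡m)
open import Data.List using (List; []; _∷_; _++_; map; concat; length; replicate; reverse; take; filter)
open import Data.List.Properties
  using (++-assoc; length-replicate; length-take; map-++; map-cong-local; reverse-++; unfold-reverse)
open import Data.List.Membership.Propositional using (_∈_)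
open import Data.List.Membership.Propositional.Properties using (∈-∃++; ∈-++⁻)
open import Data.List.Membership.DecPropositional _≟_ using (_∈?_)
open import Data.List.Relation.Unary.Any using (here; there)
open import Data.List.Relation.Unary.All as All using (All; []; _∷_)
open import Data.List.Relation.Unary.All.Properties
  using (all-filter; replicate⁺) renaming (++⁺ to All-++⁺)
open import Data.List.Relation.Unary.AllPairs using ([]; _∷_)
open import Data.List.Relation.Unary.Unique.Propositional using (Unique)
open import Data.List.Relation.Binary.Pointwise using (_∷_; []; ≡⇒Pointwise-≡)
open import Data.List.Relation.Binary.Sublist.Propositional
  using (_⊆_; []; _∷_; _∷ʳ_; ⊆-refl; ⊆-reflexive; ⊆-trans; minimum; lookup)
open import Data.List.Relation.Binary.Sublist.Propositional.Properties
  using (++⁺; ++⁺ˡ; ++⁺ʳ; ∷ˡ⁻; filter-⊆; take-⊆; reverse⁺; All-resp-⊆)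
open import Data.List.Relation.Binary.Sublist.Heterogeneous using (fromAny)
open import Data.List.Relation.Binary.Permutation.Propositional
  using (_↭_; ↭-refl; ↭-sym; ↭-trans; ↭-prep; ↭⇒↭ₛ)
open import Data.List.Relation.Binary.Permutation.Propositional.Properties
  using (∈-resp-↭; ↭-length; ↭-reverse; ++-comm)
import Data.List.Relation.Binary.Permutation.Setoid.Properties as PermutationSetoid
open import Data.Product using (∃; ∃₂; _×_; _,_)
open import Data.Sum using (_⊎_; inj₁; inj₂; swap)
open import Function using (_∘_; id)
open import Relation.Binary.Definitions using (tri<; tri≈; tri>)
open import Relation.Binary.PropositionalEquality
  using (_≡_; _≢_; refl; sym; trans; cong; cong₂; subst; setoid)
open import Relation.Nullary using (¬_; yes; no)
open import Relation.Unary using (Decidable)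

Unique-resp-⊇ : ∀ {xs ys : Seq} → xs ⊆ ys → Unique ys → Unique xs
Unique-resp-⊇ []         []          = []
Unique-resp-⊇ (_ ∷ʳ τ)   (_ ∷ ys!)   = Unique-resp-⊇ τ ys!
Unique-resp-⊇ (refl ∷ τ) (y∉ ∷ ys!) = All-resp-⊆ τ y∉ ∷ Unique-resp-⊇ τ ys!

Unique-resp-↭ : ∀ {xs ys : Seq} → xs ↭ ys → Unique xs → Unique ys
Unique-resp-↭ π = PermutationSetoid.Unique-resp-↭ (setoid ℕ) (↭⇒↭ₛ π)

range-≥ : ∀ c m → All (c ≤_) (range c m)
range-≥ c zero    = []
range-≥ c (suc m) = ≤-refl ∷ All.map (≤-trans (n≤1+n c)) (range-≥ (suc c) m)

range-unique : ∀ c m → Unique (range c m)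
range-unique c zero    = []
range-unique c (suc m) = All.map <⇒≢ (range-≥ (suc c) m) ∷ range-unique (suc c) m

length-range : ∀ c m → length (range c m) ≡ m
length-range c zero    = refl
length-range c (suc m) = cong suc (length-range (suc c) m)

map-⊆-preimage : ∀ (f : ℕ → ℕ) {u} v → u ⊆ map f v → ∃ λ v′ → v′ ⊆ v × map f v′ ≡ u
map-⊆-preimage f []      []       = [] , [] , refl
map-⊆-preimage f (y ∷ v) (_ ∷ʳ τ) with v′ , v′⊆v , eq ← map-⊆-preimage f v τ = v′ , y ∷ʳ v′⊆v , eq
map-⊆-preimage f (y ∷ v) (refl ∷ τ) with v′ , v′⊆v , eq ← map-⊆-preimage f v τ =
  y ∷ v′ , refl ∷ v′⊆v , cong (f y ∷_) eq

Contains-⊆ : ∀ {w u u′} → u′ ⊆ u → Contains w u → Contains w u′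
Contains-⊆ τ (v , v⊆w , f , f-inj , refl) with v′ , v′⊆v , refl ← map-⊆-preimage f v τ =
  v′ , ⊆-trans v′⊆v v⊆w , f , (λ x y x∈ y∈ → f-inj x y (lookup v′⊆v x∈) (lookup v′⊆v y∈)) , refl

abbab : Seq
abbab = 1 ∷ 2 ∷ 2 ∷ 1 ∷ 1 ∷ []

abbab⊆uSeq : ∀ {n} → 3 ≤ n → abbab ⊆ uSeq n
abbab⊆uSeq {suc (suc (suc m))} (s≤s (s≤s (s≤s _))) =
  refl ∷ refl ∷ 3 ∷ʳ ++⁺ˡ (range 4 m) (refl ∷ refl ∷ ++⁺ˡ (range 3 (suc m)) (refl ∷ []))

Contains-abbab : ∀ {w} → Contains w abbab → ∃₂ λ a b → a ≢ b × a ∷ b ∷ b ∷ a ∷ a ∷ [] ⊆ w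
Contains-abbab (a ∷ b ∷ c ∷ d ∷ e ∷ [] , τ , f , f-inj , eq)
  with fa ∷ fb ∷ fc ∷ fd ∷ fe ∷ [] ← ≡⇒Pointwise-≡ eq
  with refl ← f-inj b c (there (here refl)) (there (there (here refl))) (trans fb (sym fc))
     | refl ← f-inj d a (there (there (there (here refl)))) (here refl) (trans fd (sym fa))
     | refl ← f-inj e a (there (there (there (there (here refl))))) (here refl) (trans fe (sym fa))
  = a , b , (λ { refl → 1≢2 (trans (sym fa) fb) }) , τ
  where
    1≢2 : 1 ≢ 2
    1≢2 ()

below-range-skips : ∀ {y t} c m R → y < c → y ∷ t ⊆ range c m ++ R → y ∷ t ⊆ R
below-range-skips c zero    R y<c τ        = τ
below-range-skips c (suc m) R y<c (_ ∷ʳ τ) = below-range-skips (suc c) m R (≤-trans y<c (n≤1+n c)) τ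
below-range-skips c (suc m) R y<c (refl ∷ τ) = ⊥-elim (<-irrefl refl y<c)

-- An increasing list holds no non-ascent x y, so y lies beyond it.
non-ascent-skips : ∀ {x y t} c m R → y ≤ x → x ∷ y ∷ t ⊆ range c m ++ R → y ∷ t ⊆ R
non-ascent-skips c zero    R y≤x τ          = ∷ˡ⁻ τ
non-ascent-skips c (suc m) R y≤x (_ ∷ʳ τ)   = non-ascent-skips (suc c) m R y≤x τ
non-ascent-skips c (suc m) R y≤x (refl ∷ τ) = below-range-skips (suc c) m R (s≤s y≤x) τ

abbab-∉-three-ranges : ∀ {a b} r → a ≢ b →
  ¬ (a ∷ b ∷ b ∷ a ∷ a ∷ [] ⊆ concat (replicate 3 (range 0 r)))
abbab-∉-three-ranges {a} {b} r a≢b τ with <-cmp a b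
... | tri≈ _ a≡b _ = a≢b a≡b
... | tri< a<b _ _
  with () ← non-ascent-skips 0 r [] ≤-refl (non-ascent-skips 0 r _ (<⇒≤ a<b)
              (non-ascent-skips 0 r _ ≤-refl (∷ˡ⁻ τ)))
... | tri> _ _ b<a
  with () ← non-ascent-skips 0 r [] ≤-refl (∷ˡ⁻ (non-ascent-skips 0 r _ ≤-refl
              (non-ascent-skips 0 r _ (<⇒≤ b<a) τ)))

concat-replicate-⊆ : ∀ (xs : Seq) {s t} → s ≤ t → concat (replicate s xs) ⊆ concat (replicate t xs)
concat-replicate-⊆ xs {zero}  _         = minimum _
concat-replicate-⊆ xs {suc s} (s≤s s≤t) = ++⁺ ⊆-refl (concat-replicate-⊆ xs s≤t)

increasing-formation : ∀ r s → IsFormation r s (concat (replicate s (range 0 r)))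
increasing-formation r s =
  range 0 r , range-unique 0 r , length-range 0 r ,
  replicate s (range 0 r) , length-replicate s , replicate⁺ s ↭-refl , refl

fw-lower : ∀ {u} → abbab ⊆ u → ∀ s → s < 4 → ¬ FwHolds u s
fw-lower abbab⊆u s (s≤s s≤3) (r , contains)
  with a , b , a≢b , τ
         ← Contains-abbab (Contains-⊆ abbab⊆u (contains _ (increasing-formation r s)))
  = abbab-∉-three-ranges r a≢b (⊆-trans τ (concat-replicate-⊆ (range 0 r) s≤3))

Monotone : Seq → Seq → Set
Monotone P T = T ⊆ P ⊎ reverse T ⊆ P

Monotone-⊆ : ∀ {P T T′} → T′ ⊆ T → Monotone P T → Monotone P T′
Monotone-⊆ τ (inj₁ σ) = inj₁ (⊆-trans τ σ)
Monotone-⊆ τ (inj₂ σ) = inj₂ (⊆-trans (reverse⁺ τ) σ)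

Monotone-∈ : ∀ {P T x} → x ∈ T → Monotone P T → x ∷ [] ⊆ P
Monotone-∈ x∈T M with Monotone-⊆ (fromAny x∈T) M
... | inj₁ σ = σ
... | inj₂ σ = σ

LongMonotone : ℕ → ℕ → Seq → Seq → Set
LongMonotone a b P T = a ≤ length T × T ⊆ P ⊎ b ≤ length T × reverse T ⊆ P

esBound : ℕ → ℕ → ℕ
esBound zero    _       = 0
esBound (suc a) zero    = 0
esBound (suc a) (suc b) = suc (esBound a (suc b) + esBound (suc a) b)

+-≤-split : ∀ {m n o p} → m + n ≤ o + p → m ≤ o ⊎ n ≤ p
+-≤-split {m} {n} {o} {p} h with m ≤? o
... | yes m≤o = inj₁ m≤o
... | no  m≰o = inj₂ (<⇒≤ (+-cancelˡ-< o n p (<-≤-trans (+-monoˡ-< n (≰⇒> m≰o)) h)))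

length-filter-cover : ∀ {P Q : ℕ → Set} (P? : Decidable P) (Q? : Decidable Q) {xs} →
  All (λ x → P x ⊎ Q x) xs → length xs ≤ length (filter P? xs) + length (filter Q? xs)
length-filter-cover P? Q? [] = z≤n
length-filter-cover P? Q? {x ∷ xs} (p⊎q ∷ cover)
  with ih ← length-filter-cover P? Q? cover | P? x | Q? x
... | yes _ | yes _ = s≤s (≤-trans ih (+-monoʳ-≤ _ (n≤1+n _)))
... | yes _ | no  _ = s≤s ih
... | no  _ | yes _ =
  subst (suc (length xs) ≤_) (sym (+-suc (length (filter P? xs)) (length (filter Q? xs)))) (s≤s ih)
... | no ¬p | no ¬q with p⊎q
...   | inj₁ p = ⊥-elim (¬p p)
...   | inj₂ q = ⊥-elim (¬q q)

∈-++-∷⁻ : ∀ (A : Seq) {B x y} → y ∈ A ++ x ∷ B → x ≢ y → y ∈ A ⊎ y ∈ B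
∈-++-∷⁻ A y∈ x≢y with ∈-++⁻ A y∈
... | inj₁ y∈A         = inj₁ y∈A
... | inj₂ (here y≡x)  = ⊥-elim (x≢y (sym y≡x))
... | inj₂ (there y∈B) = inj₂ y∈B

extend-in-suffix : ∀ {a b x xs T} (A : Seq) {B} → T ⊆ xs → LongMonotone a (suc b) B T →
  ∃ λ T′ → T′ ⊆ x ∷ xs × LongMonotone (suc a) (suc b) (A ++ x ∷ B) T′
extend-in-suffix {x = x} {T = T} A T⊆xs (inj₁ (l , σ)) =
  x ∷ T , refl ∷ T⊆xs , inj₁ (s≤s l , ++⁺ˡ A (refl ∷ σ))
extend-in-suffix {x = x} {T = T} A T⊆xs (inj₂ (l , σ)) =
  T , x ∷ʳ T⊆xs , inj₂ (l , ++⁺ˡ A (x ∷ʳ σ))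

extend-in-prefix : ∀ {a b x xs T A} B → T ⊆ xs → LongMonotone (suc a) b A T →
  ∃ λ T′ → T′ ⊆ x ∷ xs × LongMonotone (suc a) (suc b) (A ++ x ∷ B) T′
extend-in-prefix {x = x} {T = T} B T⊆xs (inj₁ (l , σ)) =
  T , x ∷ʳ T⊆xs , inj₁ (l , ++⁺ʳ (x ∷ B) σ)
extend-in-prefix {x = x} {T = T} B T⊆xs (inj₂ (l , σ)) =
  x ∷ T , refl ∷ T⊆xs ,
  inj₂ (s≤s l , subst (_⊆ _) (sym (unfold-reverse x T)) (++⁺ σ (refl ∷ minimum B)))

-- Split P = A x B at the head x of xs: the other letters lying in B can follow x in an
-- increasing run, those lying in A can precede it in a decreasing one, and by the recursion
-- defining esBound one of the two parts is long enough.
erdős–szekeres : ∀ a b {P} xs → Unique xs → All (_∈ P) xs → esBound a b ≤ length xs →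
  ∃ λ T → T ⊆ xs × LongMonotone a b P T
erdős–szekeres zero    _       xs _ _ _ = [] , minimum xs , inj₁ (z≤n , minimum _)
erdős–szekeres (suc a) zero    xs _ _ _ = [] , minimum xs , inj₂ (z≤n , minimum _)
erdős–szekeres (suc a) (suc b) (x ∷ xs) (x∉xs ∷ xs!) (x∈P ∷ xs∈P) (s≤s h)
  with A , B , refl ← ∈-∃++ x∈P
  with +-≤-split (≤-trans h (length-filter-cover (_∈? B) (_∈? A)
         (All.zipWith (λ (y∈P , x≢y) → swap (∈-++-∷⁻ A y∈P x≢y)) (xs∈P , x∉xs))))
... | inj₁ long-in-B
  with T , T⊆ , long ← erdős–szekeres a (suc b) (filter (_∈? B) xs)
                         (Unique-resp-⊇ (filter-⊆ (_∈? B) xs) xs!) (all-filter (_∈? B) xs) long-in-B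
  = extend-in-suffix A (⊆-trans T⊆ (filter-⊆ (_∈? B) xs)) long
... | inj₂ long-in-A
  with T , T⊆ , long ← erdős–szekeres (suc a) b (filter (_∈? A) xs)
                         (Unique-resp-⊇ (filter-⊆ (_∈? A) xs) xs!) (all-filter (_∈? A) xs) long-in-A
  = extend-in-prefix B (⊆-trans T⊆ (filter-⊆ (_∈? A) xs)) long

erdős–szekeres-diagonal : ∀ b {P} xs → Unique xs → All (_∈ P) xs → esBound b b ≤ length xs →
  ∃ λ T → T ⊆ xs × b ≤ length T × Monotone P T
erdős–szekeres-diagonal b xs xs! xs∈P h with erdős–szekeres b b xs xs! xs∈P h
... | T , T⊆xs , inj₁ (l , σ) = T , T⊆xs , l , inj₁ σ
... | T , T⊆xs , inj₂ (l , σ) = T , T⊆xs , l , inj₂ σ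

esIterate : ℕ → ℕ → ℕ
esIterate zero    k = k
esIterate (suc m) k = esBound (esIterate m k) (esIterate m k)

monotone-in-all : ∀ k (Ps : List Seq) xs → Unique xs → All (λ P → All (_∈ P) xs) Ps →
  esIterate (length Ps) k ≤ length xs →
  ∃ λ T → T ⊆ xs × length T ≡ k × All (λ P → Monotone P T) Ps
monotone-in-all k [] xs _ _ k≤|xs| =
  take k xs , take-⊆ k xs , trans (length-take k xs) (m≤n⇒m⊓n≡m k≤|xs|) , []
monotone-in-all k (P ∷ Ps) xs xs! (xs∈P ∷ xs∈Ps) h
  with T , T⊆xs , b≤|T| , T-monotone
         ← erdős–szekeres-diagonal (esIterate (length Ps) k) xs xs! xs∈P h
  with U , U⊆T , |U| , U-monotone ← monotone-in-all k Ps T (Unique-resp-⊇ T⊆xs xs!)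
                                      (All.map (All-resp-⊆ T⊆xs) xs∈Ps) b≤|T|
  = U , ⊆-trans U⊆T T⊆xs , |U| , Monotone-⊆ U⊆T T-monotone ∷ U-monotone

-- uSeq n is, definitionally, shape (range 1 n) for n ≥ 2.
shape : Seq → Seq
shape (x₁ ∷ x₂ ∷ Y) = x₁ ∷ x₂ ∷ Y ++ x₂ ∷ x₁ ∷ Y ++ x₁ ∷ []
shape _             = []

map-shape : ∀ (f : ℕ → ℕ) X → map f (shape X) ≡ shape (map f X)
map-shape f []            = refl
map-shape f (_ ∷ [])      = refl
map-shape f (x₁ ∷ x₂ ∷ Y) = cong (λ z → f x₁ ∷ f x₂ ∷ z)
  (trans (map-++ f Y _) (cong (λ z → map f Y ++ f x₂ ∷ f x₁ ∷ z) (map-++ f Y (x₁ ∷ []))))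

position : ℕ → Seq → ℕ
position x []       = 0
position x (y ∷ ys) with x ≟ y
... | yes _ = 0
... | no  _ = suc (position x ys)

position-map : ∀ k X → Unique X → map (λ x → k + position x X) X ≡ range k (length X)
position-map k []       []           = refl
position-map k (y ∷ ys) (y∉ys ∷ ys!) =
  cong₂ _∷_ at-y (trans (map-cong-local (All.map shift y∉ys)) (position-map (suc k) ys ys!))
  where
    at-y : k + position y (y ∷ ys) ≡ k
    at-y with y ≟ y
    ... | yes _   = +-identityʳ k
    ... | no  y≢y = ⊥-elim (y≢y refl)
    shift : ∀ {x} → y ≢ x → k + position x (y ∷ ys) ≡ suc k + position x ys
    shift {x} y≢x with x ≟ y
    ... | yes refl = ⊥-elim (y≢x refl)
    ... | no  _    = +-suc k (position x ys)

position-injective : ∀ X {x y} → x ∈ X → y ∈ X → position x X ≡ position y X → x ≡ y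
position-injective (z ∷ zs) {x} {y} x∈ y∈ eq with x ≟ z | y ≟ z
position-injective (z ∷ zs) x∈         y∈         eq | yes x≡z | yes y≡z = trans x≡z (sym y≡z)
position-injective (z ∷ zs) (here x≡z) y∈         eq | no  x≢z | _       = ⊥-elim (x≢z x≡z)
position-injective (z ∷ zs) x∈         (here y≡z) eq | _       | no  y≢z = ⊥-elim (y≢z y≡z)
position-injective (z ∷ zs) (there x∈) (there y∈) eq | no  _   | no  _   =
  position-injective zs x∈ y∈ (suc-injective eq)

shape-Contains : ∀ {x₁ x₂ Y W} → Unique (x₁ ∷ x₂ ∷ Y) → shape (x₁ ∷ x₂ ∷ Y) ⊆ W →
  Contains W (uSeq (length (x₁ ∷ x₂ ∷ Y)))
shape-Contains {x₁} {x₂} {Y} X! τ =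
  shape X , τ , f , f-injective , trans (map-shape f X) (cong shape (position-map 1 X X!))
  where
    X : Seq
    X = x₁ ∷ x₂ ∷ Y
    f : ℕ → ℕ
    f x = 1 + position x X
    shape⊆X : All (_∈ X) (shape X)
    shape⊆X = All-++⁺ (All.tabulate id)
      (there (here refl) ∷ here refl ∷ All-++⁺ (All.tabulate (there ∘ there)) (here refl ∷ []))
    f-injective : ∀ x y → x ∈ shape X → y ∈ shape X → f x ≡ f y → x ≡ y
    f-injective x y x∈ y∈ fx≡fy =
      position-injective X (All.lookup shape⊆X x∈) (All.lookup shape⊆X y∈) (suc-injective fx≡fy)

ShapedIn : Seq → Seq → Set
ShapedIn S W = ∃₂ λ x₁ x₂ → ∃ λ Y → x₁ ∷ x₂ ∷ Y ↭ S × shape (x₁ ∷ x₂ ∷ Y) ⊆ W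

ShapedIn-Contains : ∀ {S W} → Unique S → ShapedIn S W → Contains W (uSeq (length S))
ShapedIn-Contains {W = W} S! (_ , _ , _ , π , τ) =
  subst (Contains W ∘ uSeq) (↭-length π) (shape-Contains (Unique-resp-↭ (↭-sym π) S!) τ)

blocks⁺ : ∀ {A₁ A₂ A₃ A₄ P₁ P₂ P₃ P₄ : Seq} → A₁ ⊆ P₁ → A₂ ⊆ P₂ → A₃ ⊆ P₃ → A₄ ⊆ P₄ →
  A₁ ++ A₂ ++ A₃ ++ A₄ ⊆ concat (P₁ ∷ P₂ ∷ P₃ ∷ P₄ ∷ [])
blocks⁺ τ₁ τ₂ τ₃ τ₄ = ++⁺ τ₁ (++⁺ τ₂ (++⁺ τ₃ (++⁺ʳ [] τ₄)))

last-two : ∀ (x y : ℕ) zs → ∃₂ λ Q a → ∃ λ b → x ∷ y ∷ zs ≡ Q ++ a ∷ b ∷ []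
last-two x y []       = [] , x , y , refl
last-two x y (z ∷ zs) with Q , a , b , eq ← last-two y z zs = x ∷ Q , a , b , cong (x ∷_) eq

-- With S = Q a b: x₁ x₂ = a b, and Y is Q or its reverse according to the orientation in P₂.
shape-from-last-two : ∀ {S Q a b P₁ P₂ P₃ P₄} → S ≡ Q ++ a ∷ b ∷ [] →
  S ⊆ P₁ → Monotone P₂ S → reverse S ⊆ P₃ → S ⊆ P₄ →
  ShapedIn S (concat (P₁ ∷ P₂ ∷ P₃ ∷ P₄ ∷ []))
shape-from-last-two {Q = Q} {a} {b} refl τ₁ M₂ τ₃ τ₄ rewrite reverse-++ Q (a ∷ b ∷ []) with M₂
... | inj₁ τ₂ =
  a , b , Q , ++-comm (a ∷ b ∷ []) Q ,
  blocks⁺ (⊆-trans (++⁺ˡ Q ⊆-refl) τ₁) (⊆-trans (++⁺ʳ _ ⊆-refl) τ₂)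
          (⊆-trans (refl ∷ refl ∷ minimum _) τ₃) (⊆-trans (++⁺ ⊆-refl (refl ∷ b ∷ʳ [])) τ₄)
... | inj₂ τ₂ =
  a , b , reverse Q , ↭-trans (↭-prep a (↭-prep b (↭-reverse Q))) (++-comm (a ∷ b ∷ []) Q) ,
  blocks⁺ (⊆-trans (++⁺ˡ Q ⊆-refl) τ₁) (⊆-trans (b ∷ʳ a ∷ʳ ⊆-refl) τ₂)
          τ₃ (⊆-trans (++⁺ˡ Q (refl ∷ b ∷ʳ [])) τ₄)

-- If S occurs forwards in P₃, the blocks supply S | s₂ | s₁ R | s₁; if backwards in both P₃ and
-- P₄, they supply s₁ | s₂ | R̄ s₂ s₁ | R̄ s₁ with R̄ = reverse R.
shape-in-four-blocks : ∀ {S P₁ P₂ P₃ P₄} → 2 ≤ length S →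
  S ⊆ P₁ → Monotone P₂ S → Monotone P₃ S → Monotone P₄ S →
  ShapedIn S (concat (P₁ ∷ P₂ ∷ P₃ ∷ P₄ ∷ []))
shape-in-four-blocks {[]}     ()            _ _ _ _
shape-in-four-blocks {_ ∷ []} (s≤s ())      _ _ _ _
shape-in-four-blocks {s₁ ∷ s₂ ∷ R} _ τ₁ M₂ (inj₁ τ₃) M₄ =
  s₁ , s₂ , R , ↭-refl ,
  blocks⁺ τ₁ (Monotone-∈ (there (here refl)) M₂)
          (⊆-trans (refl ∷ s₂ ∷ʳ ⊆-refl) τ₃) (Monotone-∈ (here refl) M₄)
shape-in-four-blocks {s₁ ∷ s₂ ∷ R} _ τ₁ M₂ (inj₂ τ₃) (inj₂ τ₄) =
  s₁ , s₂ , reverse R , ↭-prep s₁ (↭-prep s₂ (↭-reverse R)) ,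
  ⊆-trans (⊆-reflexive (cong (λ z → s₁ ∷ s₂ ∷ z) regroup))
    (blocks⁺ (Monotone-∈ (here refl) (inj₁ τ₁)) (Monotone-∈ (there (here refl)) M₂)
             (subst (_⊆ _) rev τ₃) (⊆-trans (++⁺ ⊆-refl (s₂ ∷ʳ ⊆-refl)) (subst (_⊆ _) rev τ₄)))
  where
    rev : reverse (s₁ ∷ s₂ ∷ R) ≡ reverse R ++ s₂ ∷ s₁ ∷ []
    rev = reverse-++ (s₁ ∷ s₂ ∷ []) R
    regroup : reverse R ++ s₂ ∷ s₁ ∷ reverse R ++ s₁ ∷ []
            ≡ (reverse R ++ s₂ ∷ s₁ ∷ []) ++ reverse R ++ s₁ ∷ []
    regroup = sym (++-assoc (reverse R) (s₂ ∷ s₁ ∷ []) (reverse R ++ s₁ ∷ []))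
shape-in-four-blocks {s₁ ∷ s₂ ∷ R} _ τ₁ M₂ (inj₂ τ₃) (inj₁ τ₄)
  with Q , a , b , S≡Qab ← last-two s₁ s₂ R = shape-from-last-two S≡Qab τ₁ M₂ τ₃ τ₄

four-blocks-contain : ∀ n {P₁ P₂ P₃ P₄} → 2 ≤ n → Unique P₁ → esIterate 3 n ≤ length P₁ →
  All (_∈ P₂) P₁ → All (_∈ P₃) P₁ → All (_∈ P₄) P₁ →
  Contains (concat (P₁ ∷ P₂ ∷ P₃ ∷ P₄ ∷ [])) (uSeq n)
four-blocks-contain n {P₁} {P₂} {P₃} {P₄} 2≤n P₁! h P₁∈P₂ P₁∈P₃ P₁∈P₄
  with S , S⊆P₁ , |S|≡n , M₂ ∷ M₃ ∷ M₄ ∷ []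
         ← monotone-in-all n (P₂ ∷ P₃ ∷ P₄ ∷ []) P₁ P₁! (P₁∈P₂ ∷ P₁∈P₃ ∷ P₁∈P₄ ∷ []) h
  = subst (Contains (concat (P₁ ∷ P₂ ∷ P₃ ∷ P₄ ∷ [])) ∘ uSeq) |S|≡n
      (ShapedIn-Contains (Unique-resp-⊇ S⊆P₁ P₁!)
        (shape-in-four-blocks (subst (2 ≤_) (sym |S|≡n) 2≤n) S⊆P₁ M₂ M₃ M₄))

All-∈-↭ : ∀ {xs ys : Seq} → xs ↭ ys → All (_∈ ys) xs
All-∈-↭ π = All.tabulate (∈-resp-↭ π)

fw-upper : ∀ n → 2 ≤ n → FwHolds (uSeq n) 4
fw-upper n 2≤n = esIterate 3 n , λ where
  _ (L , L! , |L| , P₁ ∷ P₂ ∷ P₃ ∷ P₄ ∷ [] , refl , π₁ ∷ π₂ ∷ π₃ ∷ π₄ ∷ [] , refl) →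
    four-blocks-contain n 2≤n (Unique-resp-↭ (↭-sym π₁) L!)
      (≤-reflexive (sym (trans (↭-length π₁) |L|)))
      (All-∈-↭ (↭-trans π₁ (↭-sym π₂))) (All-∈-↭ (↭-trans π₁ (↭-sym π₃)))
      (All-∈-↭ (↭-trans π₁ (↭-sym π₄)))

lemma8 : (n : ℕ) → 3 ≤ n → FwEq (uSeq n) 4
lemma8 n 3≤n = fw-upper n (≤-trans (n≤1+n 2) 3≤n) , λ s s<4 → fw-lower (abbab⊆uSeq 3≤n) s s<4
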